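{- Let $G=(V,E)$ be a graph and $\mathcal{U}$ a set of utter cliques of $G$ such that $\bigcup_{[W,F]\in\mathcal{U}}E(W)=E$. Then the extended incidence vectors of the co-2-plexes of $G$ are exactly the vectors $(x,y)\in\{0,1\}^V\times\{0,1\}^E$ satisfying $x(W)+y(F\cap E(V\setminus W))-y(E(W))\le 1$ for all $[W,F]\in\mathcal{U}$ and $y(\delta(v))\le x_v$ for all $v\in V$.
   Context: $E(W)$ is the set of edges with both endpoints in $W$, $\delta(v)$ the set of edges incident to $v$, $x(S)=\sum_{s\in S}x_s$. A co-2-plex is a vertex set $S$ such that $G[S]$ has maximum degree at most $1$; its extended incidence vector is $(\chi^S,\zeta^{E(S)})$ where $\chi^S\in\{0,1\}^V$ and $\zeta^{E(S)}\in\{0,1\}^E$ are the incidence vectors of $S$ and of $E(S)$. The utter graph $u(G)$ has vertex set $V\cup E$; two vertices of $G$ are adjacent in $u(G)$ iff adjacent in $G$; a vertex $w$ and an edge $uv$ are adjacent iff $w\in\{u,v\}$ or $w$ is adjacent in $G$ to $u$ or $v$; two edges are adjacent iff they share an endpoint, or are disjoint and some edge of $G$ joins an endpoint of one to an endpoint of the other. $[W,F]$ ($W\subseteq V$, $F\subseteq E$) is an utter clique if $W\cup F$ is a clique of $u(G)$. -}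

module Defs where

open import Data.Nat using (ℕ; zero; suc; _+_; _≤_)
open import Data.Fin using (Fin; zero; suc; _≟_)
open import Data.Bool using (Bool; true; false; _∧_; _∨_; not; if_then_else_)
open import Data.Product using (Σ; _×_; _,_; ∃; ∃-syntax)
open import Data.Sum using (_⊎_)
open import Relation.Nullary using (¬_)
open import Relation.Nullary.Decidable using (⌊_⌋)
open import Relation.Binary.PropositionalEquality using (_≡_; _≢_)

count : ∀ {k} → (Fin k → Bool) → ℕ
count {zero}  p = 0
count {suc k} p = (if p zero then 1 else 0) + count (λ i → p (suc i))

⟦_⟧ : Bool → ℕ
⟦ b ⟧ = if b then 1 else 0

record Graph : Set where
  field
    n m : ℕ
    src tgt : Fin m → Fin n
    loopless : ∀ e → src e ≢ tgt e
    simple : ∀ e f →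
      ((src e ≡ src f × tgt e ≡ tgt f) ⊎ (src e ≡ tgt f × tgt e ≡ src f)) → e ≡ f

module _ (G : Graph) where
  open Graph G

  VSet : Set
  VSet = Fin n → Bool

  ESet : Set
  ESet = Fin m → Bool

  Adj : Fin n → Fin n → Set
  Adj u v = ∃[ e ] ((src e ≡ u × tgt e ≡ v) ⊎ (src e ≡ v × tgt e ≡ u))

  incident : Fin n → Fin m → Bool
  incident v e = ⌊ src e ≟ v ⌋ ∨ ⌊ tgt e ≟ v ⌋

  inE : VSet → Fin m → Bool
  inE W e = W (src e) ∧ W (tgt e)

  inEcompl : VSet → Fin m → Bool
  inEcompl W e = not (W (src e)) ∧ not (W (tgt e))

  IsCo2Plex : VSet → Set
  IsCo2Plex S = ∀ v → S v ≡ true → count (λ e → inE S e ∧ incident v e) ≤ 1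

  IsEnd : Fin n → Fin m → Set
  IsEnd w e = w ≡ src e ⊎ w ≡ tgt e

  -- adjacency in the utter graph u(G)
  UAdjVV : Fin n → Fin n → Set
  UAdjVV = Adj

  UAdjVE : Fin n → Fin m → Set
  UAdjVE w e = IsEnd w e ⊎ Adj w (src e) ⊎ Adj w (tgt e)

  ShareEnd : Fin m → Fin m → Set
  ShareEnd e f = ∃[ w ] (IsEnd w e × IsEnd w f)

  UAdjEE : Fin m → Fin m → Set
  UAdjEE e f = ShareEnd e f
             ⊎ (¬ ShareEnd e f × ∃[ a ] ∃[ b ] (IsEnd a e × IsEnd b f × Adj a b))

  IsUtterClique : VSet → ESet → Set
  IsUtterClique W F =
    (∀ w w' → W w ≡ true → W w' ≡ true → w ≢ w' → UAdjVV w w')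
    × (∀ w e → W w ≡ true → F e ≡ true → UAdjVE w e)
    × (∀ e f → F e ≡ true → F f ≡ true → e ≢ f → UAdjEE e f)

  IsExtIncidence : VSet → VSet → ESet → Set
  IsExtIncidence S x y = (∀ v → x v ≡ S v) × (∀ e → y e ≡ inE S e)

  -- the utter-clique inequality for [W,F], with the term -y(E(W)) moved to
  -- the right-hand side (natural-number arithmetic):
  --   x(W) + y(F ∩ E(V∖W)) ≤ 1 + y(E(W))
  CliqueIneq : VSet → ESet → VSet → ESet → Set
  CliqueIneq x y W F =
    count (λ v → x v ∧ W v) + count (λ e → y e ∧ F e ∧ inEcompl W e)
      ≤ 1 + count (λ e → y e ∧ inE W e)

  DegreeIneq : VSet → ESet → Fin n → Set
  DegreeIneq x y v = count (λ e → y e ∧ incident v e) ≤ ⟦ x v ⟧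

-- Necessity: in a co-2-plex S every vertex meets at most one edge of E(S). Two
-- vertices of S ∩ W are adjacent, so |S ∩ W| ≤ 2 with equality only if E(S ∩ W)
-- is non-empty; and an edge of F ∩ E(S) outside W is utter-adjacent to every
-- vertex of W and every other edge of F, which forces S ∩ W = ∅ and
-- |F ∩ E(S) ∩ E(V ∖ W)| ≤ 1.
--
-- Sufficiency: the degree inequalities say that y is a matching on the vertices
-- of x. An edge e ⊆ x lies in some E(W) with [W,F] ∈ 𝒰; the y-edges in E(W) are
-- a matching on x ∩ W, so 2 y(E(W)) ≤ x(W) ≤ 1 + y(E(W)). Together with
-- x(W) ≥ 2 this gives x(W) = 2 and y(E(W)) = 1, and by simplicity the y-edge
-- in E(W) must be e itself. Hence y = ζ^{E(x)}, and x is a co-2-plex.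
module Submission where

open import Defs
open import Data.Bool using (Bool; true; false; _∧_; not)
open import Data.Bool.Properties using (∧-identityʳ)
open import Data.Nat using (ℕ; zero; suc; _+_; _≤_; z≤n; s≤s; _≤?_)
open import Data.Nat.Properties
  using (≤-trans; ≤-reflexive; ≤-pred; ≰⇒>; m≤n+m; m+n≤o⇒m≤o; +-suc; +-identityʳ; +-cancelʳ-≤)
import Data.Nat.Properties as ℕ
open import Data.Fin using (Fin; zero; suc; _≟_)
open import Data.Fin.Properties using (suc-injective; 0≢1+n)
open import Data.Empty using (⊥; ⊥-elim)
open import Data.Sum using (_⊎_; inj₁; inj₂)
open import Data.Product using (_×_; _,_; ∃-syntax; proj₁; proj₂)
open import Function using (_∘_)
open import Function.Bundles using (_⇔_; mk⇔)
open import Relation.Nullary using (¬_; yes; no; does)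
open import Relation.Binary.PropositionalEquality
  using (_≡_; _≢_; _≗_; refl; sym; trans; cong; cong₂; subst; subst₂)

∧-trueˡ : ∀ {a b} → a ∧ b ≡ true → a ≡ true
∧-trueˡ {true} _ = refl

∧-trueʳ : ∀ {a b} → a ∧ b ≡ true → b ≡ true
∧-trueʳ {true} b = b

∧-true : ∀ {a b} → a ≡ true → b ≡ true → a ∧ b ≡ true
∧-true refl refl = refl

not-true : ∀ {a} → not a ≡ true → a ≡ false
not-true {false} _ = refl

true≢false : true ≢ false
true≢false ()

module _ {k : ℕ} where

  infixl 6 _─_

  -- does, not ⌊_⌋: only does computes through _≟_ on suc, which count-remove needs.
  _─_ : (Fin k → Bool) → Fin k → Fin k → Bool
  (p ─ i) j = p j ∧ not (does (j ≟ i))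

  ─-intro : ∀ (p : Fin k → Bool) {i j} → p j ≡ true → j ≢ i → (p ─ i) j ≡ true
  ─-intro p {i} {j} pj j≢i with j ≟ i
  ... | yes j≡i = ⊥-elim (j≢i j≡i)
  ... | no _ rewrite pj = refl

  ─-member : ∀ (p : Fin k → Bool) {i j} → (p ─ i) j ≡ true → p j ≡ true
  ─-member p = ∧-trueˡ

  ─-≢ : ∀ (p : Fin k → Bool) {i j} → (p ─ i) j ≡ true → j ≢ i
  ─-≢ p {i} {j} h with j ≟ i
  ... | yes _ = λ _ → true≢false (sym (∧-trueʳ {p j} h))
  ... | no j≢i = j≢i

count-cong : ∀ {k} {p q : Fin k → Bool} → p ≗ q → count p ≡ count q
count-cong {zero} eq = refl
count-cong {suc k} eq = cong₂ _+_ (cong ⟦_⟧ (eq zero)) (count-cong (eq ∘ suc))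

count-mono : ∀ {k} {p q : Fin k → Bool} → (∀ i → p i ≡ true → q i ≡ true) → count p ≤ count q
count-mono {zero} _ = z≤n
count-mono {suc k} {p} {q} p⊆q with p zero in p0 | q zero in q0
... | false | false = count-mono (p⊆q ∘ suc)
... | false | true = ≤-trans (count-mono (p⊆q ∘ suc)) (m≤n+m _ 1)
... | true | false = ⊥-elim (true≢false (trans (sym (p⊆q zero p0)) q0))
... | true | true = s≤s (count-mono (p⊆q ∘ suc))

count-≡0 : ∀ {k} (p : Fin k → Bool) → (∀ i → p i ≢ true) → count p ≡ 0
count-≡0 {zero} p _ = refl
count-≡0 {suc k} p none with p zero in p0
... | true = ⊥-elim (none zero p0)
... | false = count-≡0 (p ∘ suc) (none ∘ suc)

count≡0⊎∃ : ∀ {k} (p : Fin k → Bool) → count p ≡ 0 ⊎ ∃[ i ] p i ≡ true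
count≡0⊎∃ {zero} p = inj₁ refl
count≡0⊎∃ {suc k} p with p zero in p0 | count≡0⊎∃ (p ∘ suc)
... | true | _ = inj₂ (zero , p0)
... | false | inj₁ c = inj₁ c
... | false | inj₂ (i , pi) = inj₂ (suc i , pi)

count-witness : ∀ {k} (p : Fin k → Bool) → 1 ≤ count p → ∃[ i ] p i ≡ true
count-witness p 1≤c with count≡0⊎∃ p
... | inj₁ c≡0 = ⊥-elim (ℕ.n≮0 (subst (1 ≤_) c≡0 1≤c))
... | inj₂ w = w

count-remove : ∀ {k} (p : Fin k → Bool) {i} → p i ≡ true → count p ≡ suc (count (p ─ i))
count-remove p {zero} pi rewrite pi = cong suc (count-cong (λ j → sym (∧-identityʳ (p (suc j)))))
count-remove p {suc i} pi with p zero
... | true = cong suc (count-remove (p ∘ suc) {i} pi)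
... | false = count-remove (p ∘ suc) {i} pi

count-≥1 : ∀ {k} (p : Fin k → Bool) {i} → p i ≡ true → 1 ≤ count p
count-≥1 p pi rewrite count-remove p pi = s≤s z≤n

count-≥2 : ∀ {k} (p : Fin k → Bool) {i j} → p i ≡ true → p j ≡ true → i ≢ j → 2 ≤ count p
count-≥2 p pi pj i≢j rewrite count-remove p pi =
  s≤s (count-≥1 (p ─ _) (─-intro p pj (i≢j ∘ sym)))

count-≥3 : ∀ {k} (p : Fin k → Bool) {i j l} → p i ≡ true → p j ≡ true → p l ≡ true
  → i ≢ j → i ≢ l → j ≢ l → 3 ≤ count p
count-≥3 p pi pj pl i≢j i≢l j≢l rewrite count-remove p pi =
  s≤s (count-≥2 (p ─ _) (─-intro p pj (i≢j ∘ sym)) (─-intro p pl (i≢l ∘ sym)) j≢l)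

count-two-witnesses : ∀ {k} (p : Fin k → Bool) → 2 ≤ count p
  → ∃[ i ] ∃[ j ] (p i ≡ true × p j ≡ true × i ≢ j)
count-two-witnesses p 2≤c with count-witness p (≤-trans (s≤s z≤n) 2≤c)
... | i , pi with count-witness (p ─ i) (≤-pred (subst (2 ≤_) (count-remove p pi) 2≤c))
...   | j , pj = i , j , pi , ─-member p pj , ─-≢ p pj ∘ sym

count-≤1 : ∀ {k} (p : Fin k → Bool) → (∀ i j → p i ≡ true → p j ≡ true → i ≡ j) → count p ≤ 1
count-≤1 {zero} p _ = z≤n
count-≤1 {suc k} p unique with p zero in p0
... | true = s≤s (≤-reflexive (count-≡0 (p ∘ suc) λ i pi → 0≢1+n (unique zero (suc i) p0 pi)))
... | false = count-≤1 (p ∘ suc) λ i j pi pj → suc-injective (unique (suc i) (suc j) pi pj)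

module _ (G : Graph) where
  open Graph G

  incident-intro : ∀ {v e} → IsEnd G v e → incident G v e ≡ true
  incident-intro {v} {e} v∈e with src e ≟ v | tgt e ≟ v
  ... | yes _ | _ = refl
  ... | no _ | yes _ = refl
  ... | no s≢v | no t≢v with v∈e
  ...   | inj₁ v≡s = ⊥-elim (s≢v (sym v≡s))
  ...   | inj₂ v≡t = ⊥-elim (t≢v (sym v≡t))

  incident-elim : ∀ {v e} → incident G v e ≡ true → IsEnd G v e
  incident-elim {v} {e} h with src e ≟ v | tgt e ≟ v
  ... | yes s≡v | _ = inj₁ (sym s≡v)
  ... | no _ | yes t≡v = inj₂ (sym t≡v)

  inE-end : ∀ (S : VSet G) {e v} → inE G S e ≡ true → IsEnd G v e → S v ≡ true
  inE-end S h (inj₁ refl) = ∧-trueˡ h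
  inE-end S {e} h (inj₂ refl) = ∧-trueʳ {S (src e)} h

  inEcompl-end : ∀ (W : VSet G) {e v} → inEcompl G W e ≡ true → IsEnd G v e → W v ≡ false
  inEcompl-end W h (inj₁ refl) = not-true (∧-trueˡ h)
  inEcompl-end W {e} h (inj₂ refl) = not-true (∧-trueʳ {not (W (src e))} h)

  adj-endˡ : ∀ {u v} (a : Adj G u v) → IsEnd G u (proj₁ a)
  adj-endˡ (_ , inj₁ (refl , _)) = inj₁ refl
  adj-endˡ (_ , inj₂ (_ , refl)) = inj₂ refl

  adj-endʳ : ∀ {u v} (a : Adj G u v) → IsEnd G v (proj₁ a)
  adj-endʳ (_ , inj₁ (_ , refl)) = inj₂ refl
  adj-endʳ (_ , inj₂ (refl , _)) = inj₁ refl

  adj-inE : ∀ (S : VSet G) {u v} → S u ≡ true → S v ≡ true → (a : Adj G u v) → inE G S (proj₁ a) ≡ true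
  adj-inE S su sv (_ , inj₁ (refl , refl)) = ∧-true su sv
  adj-inE S su sv (_ , inj₂ (refl , refl)) = ∧-true sv su

  adj-ends : ∀ {u v w} (a : Adj G u v) → IsEnd G w (proj₁ a) → w ≡ u ⊎ w ≡ v
  adj-ends (_ , inj₁ (refl , refl)) (inj₁ refl) = inj₁ refl
  adj-ends (_ , inj₁ (refl , refl)) (inj₂ refl) = inj₂ refl
  adj-ends (_ , inj₂ (refl , refl)) (inj₁ refl) = inj₂ refl
  adj-ends (_ , inj₂ (refl , refl)) (inj₂ refl) = inj₁ refl

  -- By simplicity, distinct edges never have the same pair of ends.
  distinct-edges-three-ends : ∀ (P : VSet G) {e f} → e ≢ f
    → (∀ {v} → IsEnd G v e → P v ≡ true) → (∀ {v} → IsEnd G v f → P v ≡ true) → 3 ≤ count P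
  distinct-edges-three-ends P {e} {f} e≢f e⊆P f⊆P
    with src f ≟ src e | src f ≟ tgt e | tgt f ≟ src e | tgt f ≟ tgt e
  ... | no s≢s | no s≢t | _ | _ =
    count-≥3 P (e⊆P (inj₁ refl)) (e⊆P (inj₂ refl)) (f⊆P (inj₁ refl)) (loopless e) (s≢s ∘ sym) (s≢t ∘ sym)
  ... | _ | _ | no t≢s | no t≢t =
    count-≥3 P (e⊆P (inj₁ refl)) (e⊆P (inj₂ refl)) (f⊆P (inj₂ refl)) (loopless e) (t≢s ∘ sym) (t≢t ∘ sym)
  ... | yes s≡s | _ | yes t≡s | _ = ⊥-elim (loopless f (trans s≡s (sym t≡s)))
  ... | yes s≡s | _ | _ | yes t≡t = ⊥-elim (e≢f (simple e f (inj₁ (sym s≡s , sym t≡t))))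
  ... | _ | yes s≡t | yes t≡s | _ = ⊥-elim (e≢f (simple e f (inj₂ (sym t≡s , sym s≡t))))
  ... | _ | yes s≡t | _ | yes t≡t = ⊥-elim (loopless f (trans s≡t (sym t≡t)))

  Clique : VSet G → Set
  Clique K = ∀ u v → K u ≡ true → K v ≡ true → u ≢ v → Adj G u v

  IsMatching : ESet G → Set
  IsMatching M = ∀ v → count (λ e → M e ∧ incident G v e) ≤ 1

  IsMatching-⊆ : ∀ {M N : ESet G} → (∀ e → M e ≡ true → N e ≡ true) → IsMatching N → IsMatching M
  IsMatching-⊆ {M} M⊆N N-matching v =
    ≤-trans (count-mono λ e h → ∧-true (M⊆N e (∧-trueˡ h)) (∧-trueʳ {M e} h)) (N-matching v)

  IsMatching-cong : ∀ {M N : ESet G} → M ≗ N → IsMatching M → IsMatching N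
  IsMatching-cong {M} M≗N M-matching = IsMatching-⊆ (λ e ne → trans (M≗N e) ne) M-matching

  matching-shared-end : ∀ {M : ESet G} → IsMatching M → ∀ {e f v}
    → M e ≡ true → M f ≡ true → IsEnd G v e → IsEnd G v f → e ≡ f
  matching-shared-end {M} M-matching {e} {f} {v} me mf v∈e v∈f with e ≟ f
  ... | yes e≡f = e≡f
  ... | no e≢f = ⊥-elim (ℕ.n≮n 1 (≤-trans
          (count-≥2 (λ g → M g ∧ incident G v g) (∧-true me (incident-intro v∈e)) (∧-true mf (incident-intro v∈f)) e≢f)
          (M-matching v)))

  -- Induction on |M|: delete an edge of M from M and both of its ends from P.
  matching-covers : ∀ {M : ESet G} {P : VSet G} → IsMatching M
    → (∀ {e v} → M e ≡ true → IsEnd G v e → P v ≡ true) → count M + count M ≤ count P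
  matching-covers {M} {P} M-matching M⊆P = go (count M) refl M-matching M⊆P
    where
    go : ∀ {M P} r → count M ≡ r → IsMatching M
       → (∀ {e v} → M e ≡ true → IsEnd G v e → P v ≡ true) → count M + count M ≤ count P
    go {M} zero c≡0 _ _ rewrite c≡0 = z≤n
    go {M} {P} (suc r) c≡r M-matching M⊆P with count-witness M (subst (1 ≤_) (sym c≡r) (s≤s z≤n))
    ... | e , me rewrite count-remove M me
                       | count-remove P (M⊆P me (inj₁ refl))
                       | count-remove (P ─ src e) (─-intro P (M⊆P me (inj₂ refl)) (loopless e ∘ sym))
                       | +-suc (count (M ─ e)) (count (M ─ e)) =
      s≤s (s≤s (go r (ℕ.suc-injective c≡r) (IsMatching-⊆ (λ _ → ─-member M) M-matching) M'⊆P'))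
      where
      M'⊆P' : ∀ {f v} → (M ─ e) f ≡ true → IsEnd G v f → (P ─ src e ─ tgt e) v ≡ true
      M'⊆P' {f} {v} mf v∈f = ─-intro (P ─ src e) (─-intro P pv (f≢e ∘ shared ∘ inj₁)) (f≢e ∘ shared ∘ inj₂)
        where
        pv = M⊆P (─-member M mf) v∈f
        f≢e = ─-≢ M mf
        shared : IsEnd G v e → f ≡ e
        shared v∈e = matching-shared-end M-matching (─-member M mf) me v∈f v∈e

-- Co-2-plexes satisfy the inequalities

  co2plex-degreeIneq : ∀ {S : VSet G} → IsCo2Plex G S → ∀ v → DegreeIneq G S (inE G S) v
  co2plex-degreeIneq {S} co v with S v in sv
  ... | true = co v sv
  ... | false = ≤-reflexive (count-≡0 _ λ e h →
          true≢false (trans (sym (inE-end S (∧-trueˡ h) (incident-elim (∧-trueʳ {inE G S e} h)))) sv))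

  degreeIneq⇒matching : ∀ {x : VSet G} {y : ESet G} → (∀ v → DegreeIneq G x y v) → IsMatching y
  degreeIneq⇒matching {x} deg v = ≤-trans (deg v) (⟦⟧≤1 (x v))
    where
    ⟦⟧≤1 : ∀ b → ⟦ b ⟧ ≤ 1
    ⟦⟧≤1 true = s≤s z≤n
    ⟦⟧≤1 false = z≤n

  co2plex-matching : ∀ {S : VSet G} → IsCo2Plex G S → IsMatching (inE G S)
  co2plex-matching co = degreeIneq⇒matching (co2plex-degreeIneq co)

  co2plex-clique-≤2 : ∀ {S K : VSet G} → IsCo2Plex G S
    → (∀ v → K v ≡ true → S v ≡ true) → Clique K → count K ≤ 2
  co2plex-clique-≤2 {S} {K} co K⊆S clique with count≡0⊎∃ K
  ... | inj₁ c≡0 = subst (_≤ 2) (sym c≡0) z≤n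
  ... | inj₂ (w , kw) rewrite count-remove K kw = s≤s (count-≤1 (K ─ w) unique)
    where
    edge-to-w : ∀ {u} → (K ─ w) u ≡ true → Adj G w u
    edge-to-w ku = clique w _ kw (─-member K ku) (─-≢ K ku ∘ sym)
    inS : ∀ {v} → (K ─ w) v ≡ true → S v ≡ true
    inS = K⊆S _ ∘ ─-member K
    unique : ∀ u u' → (K ─ w) u ≡ true → (K ─ w) u' ≡ true → u ≡ u'
    unique u u' ku ku' = resolve (adj-ends a' (subst (IsEnd G u) a≡a' (adj-endʳ a)))
      where
      a = edge-to-w ku
      a' = edge-to-w ku'
      a≡a' : proj₁ a ≡ proj₁ a'
      a≡a' = matching-shared-end (co2plex-matching co)
               (adj-inE S (K⊆S w kw) (inS ku) a) (adj-inE S (K⊆S w kw) (inS ku') a')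
               (adj-endˡ a) (adj-endˡ a')
      resolve : u ≡ w ⊎ u ≡ u' → u ≡ u'
      resolve (inj₁ u≡w) = ⊥-elim (─-≢ K ku u≡w)
      resolve (inj₂ u≡u') = u≡u'

  clique-has-edge : ∀ {K : VSet G} → Clique K → 2 ≤ count K → ∃[ e ] inE G K e ≡ true
  clique-has-edge {K} clique 2≤c with count-two-witnesses K 2≤c
  ... | u , v , ku , kv , u≢v = let a = clique u v ku kv u≢v in proj₁ a , adj-inE K ku kv a

  clique-∩ : ∀ (S : VSet G) {W : VSet G} → Clique W → Clique (λ v → S v ∧ W v)
  clique-∩ S clique u v su sv = clique u v (∧-trueʳ {S u} su) (∧-trueʳ {S v} sv)

  inE-∩ : ∀ (S W : VSet G) {e} → inE G (λ v → S v ∧ W v) e ≡ true → (inE G S e ∧ inE G W e) ≡ true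
  inE-∩ S W {e} h = ∧-true (∧-true (∧-trueˡ {S (src e)} s) (∧-trueˡ {S (tgt e)} t)) (∧-true (∧-trueʳ {S (src e)} s) (∧-trueʳ {S (tgt e)} t))
    where
    s : S (src e) ∧ W (src e) ≡ true
    s = ∧-trueˡ h
    t : S (tgt e) ∧ W (tgt e) ≡ true
    t = ∧-trueʳ {S (src e) ∧ W (src e)} h

  co2plex-vertex-bound : ∀ {S W : VSet G} → IsCo2Plex G S → Clique W
    → count (λ v → S v ∧ W v) ≤ 1 + count (λ e → inE G S e ∧ inE G W e)
  co2plex-vertex-bound {S} {W} co clique with count (λ v → S v ∧ W v) ≤? 1
  ... | yes ≤1 = ≤-trans ≤1 (s≤s z≤n)
  ... | no ≰1 with clique-has-edge (clique-∩ S clique) (≰⇒> ≰1)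
  ...   | e , e∈E[S∩W] = ≤-trans (co2plex-clique-≤2 co (λ _ → ∧-trueˡ) (clique-∩ S clique))
                           (s≤s (count-≥1 (λ e → inE G S e ∧ inE G W e) (inE-∩ S W e∈E[S∩W])))

  co2plex-no-utterAdjVE : ∀ {S : VSet G} → IsCo2Plex G S → ∀ {w e}
    → S w ≡ true → inE G S e ≡ true → ¬ IsEnd G w e → ¬ UAdjVE G w e
  co2plex-no-utterAdjVE {S} co {w} {e} sw es w∉e = λ where
      (inj₁ w∈e) → w∉e w∈e
      (inj₂ (inj₁ a)) → via a (inj₁ refl)
      (inj₂ (inj₂ a)) → via a (inj₂ refl)
    where
    via : ∀ {z} (a : Adj G w z) → IsEnd G z e → ⊥
    via a z∈e = w∉e (subst (IsEnd G w) a≡e (adj-endˡ a))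
      where
      a≡e = matching-shared-end (co2plex-matching co)
              (adj-inE S sw (inE-end S es z∈e) a) es (adj-endʳ a) z∈e

  co2plex-no-utterAdjEE : ∀ {S : VSet G} → IsCo2Plex G S → ∀ {e f}
    → inE G S e ≡ true → inE G S f ≡ true → e ≢ f → ¬ UAdjEE G e f
  co2plex-no-utterAdjEE {S} co {e} {f} es fs e≢f = λ where
      (inj₁ (w , w∈e , w∈f)) → e≢f (shared es fs w∈e w∈f)
      (inj₂ (disjoint , a , b , a∈e , b∈f , g)) →
        let g≡e = shared (adj-inE S (inE-end S es a∈e) (inE-end S fs b∈f) g) es (adj-endˡ g) a∈e
        in disjoint (b , subst (IsEnd G b) g≡e (adj-endʳ g) , b∈f)
    where
    shared = matching-shared-end (co2plex-matching co)

  co2plex-utter-edges-≤1 : ∀ {S W : VSet G} {F : ESet G} → IsCo2Plex G S → IsUtterClique G W F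
    → count (λ e → inE G S e ∧ F e ∧ inEcompl G W e) ≤ 1
  co2plex-utter-edges-≤1 {S} {W} {F} co (_ , _ , ee) = count-≤1 _ unique
    where
    unique : ∀ e f → (inE G S e ∧ F e ∧ inEcompl G W e) ≡ true → (inE G S f ∧ F f ∧ inEcompl G W f) ≡ true
           → e ≡ f
    unique e f qe qf with e ≟ f
    ... | yes e≡f = e≡f
    ... | no e≢f = ⊥-elim (co2plex-no-utterAdjEE co (∧-trueˡ qe) (∧-trueˡ qf) e≢f
                     (ee e f (∧-trueˡ (∧-trueʳ {inE G S e} qe)) (∧-trueˡ (∧-trueʳ {inE G S f} qf)) e≢f))

  co2plex-utter-edge-avoids-W : ∀ {S W : VSet G} {F : ESet G} → IsCo2Plex G S → IsUtterClique G W F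
    → ∀ {e} → (inE G S e ∧ F e ∧ inEcompl G W e) ≡ true → count (λ v → S v ∧ W v) ≡ 0
  co2plex-utter-edge-avoids-W {S} {W} {F} co (_ , ve , _) {e} qe = count-≡0 _ λ w h →
    let ww = ∧-trueʳ {S w} h
    in co2plex-no-utterAdjVE co (∧-trueˡ h) (∧-trueˡ qe)
         (λ w∈e → true≢false (trans (sym ww) (inEcompl-end W (∧-trueʳ {F e} (∧-trueʳ {inE G S e} qe)) w∈e)))
         (ve w e ww (∧-trueˡ (∧-trueʳ {inE G S e} qe)))

  co2plex-cliqueIneq : ∀ {S W : VSet G} {F : ESet G} → IsCo2Plex G S → IsUtterClique G W F
    → CliqueIneq G S (inE G S) W F
  co2plex-cliqueIneq {S} {W} {F} co utter with count≡0⊎∃ (λ e → inE G S e ∧ F e ∧ inEcompl G W e)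
  ... | inj₁ Q≡0 rewrite Q≡0 | +-identityʳ (count (λ v → S v ∧ W v)) =
    co2plex-vertex-bound co (proj₁ utter)
  ... | inj₂ (_ , qe) rewrite co2plex-utter-edge-avoids-W co utter qe =
    ≤-trans (co2plex-utter-edges-≤1 co utter) (s≤s z≤n)

  cliqueIneq-cong : ∀ {x x' W : VSet G} {y y' : ESet G} {F : ESet G} → x ≗ x' → y ≗ y'
    → CliqueIneq G x y W F → CliqueIneq G x' y' W F
  cliqueIneq-cong {W = W} {F = F} x≗x' y≗y' =
    subst₂ _≤_ (cong₂ _+_ (count-cong λ v → cong (_∧ W v) (x≗x' v))
                          (count-cong λ e → cong (_∧ (F e ∧ inEcompl G W e)) (y≗y' e)))
               (cong suc (count-cong λ e → cong (_∧ inE G W e) (y≗y' e)))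

  degreeIneq-cong : ∀ {x x' : VSet G} {y y' : ESet G} → x ≗ x' → y ≗ y'
    → ∀ {v} → DegreeIneq G x y v → DegreeIneq G x' y' v
  degreeIneq-cong x≗x' y≗y' {v} =
    subst₂ _≤_ (count-cong λ e → cong (_∧ incident G v e) (y≗y' e)) (cong ⟦_⟧ (x≗x' v))

-- Solutions of the inequalities are co-2-plexes

  degreeIneq⇒ends : ∀ {x : VSet G} {y : ESet G} → (∀ v → DegreeIneq G x y v)
    → ∀ {e v} → y e ≡ true → IsEnd G v e → x v ≡ true
  degreeIneq⇒ends {x} {y} degree {e} {v} ye v∈e with x v in xv
  ... | true = refl
  ... | false = ⊥-elim (ℕ.n≮0 (≤-trans (count-≥1 (λ f → y f ∧ incident G v f) (∧-true ye (incident-intro v∈e)))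
                                      (subst (λ b → _ ≤ ⟦ b ⟧) xv (degree v))))

  -- 2 y(E(W)) ≤ x(W) ≤ 1 + y(E(W)) leaves no room for a third vertex in x ∩ W.
  matching-saturates : ∀ {x W : VSet G} {y : ESet G} → IsMatching y
    → (∀ {e v} → y e ≡ true → IsEnd G v e → x v ≡ true)
    → count (λ v → x v ∧ W v) ≤ 1 + count (λ e → y e ∧ inE G W e)
    → ∀ {e} → inE G x e ≡ true → inE G W e ≡ true → y e ≡ true
  matching-saturates {x} {W} {y} y-matching y⊆x bound {e} ex ew with y e in ye
  ... | true = refl
  ... | false = ⊥-elim (ℕ.n≮n 1 (≤-trans 2≤r r≤1))
    where
    P : VSet G
    P v = x v ∧ W v
    R : ESet G
    R f = y f ∧ inE G W f
    e⊆P : ∀ {v} → IsEnd G v e → P v ≡ true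
    e⊆P v∈e = ∧-true (inE-end x ex v∈e) (inE-end W ew v∈e)
    R⊆P : ∀ {f v} → R f ≡ true → IsEnd G v f → P v ≡ true
    R⊆P {f} rf v∈f = ∧-true (y⊆x (∧-trueˡ rf) v∈f) (inE-end W (∧-trueʳ {y f} rf) v∈f)
    2≤P : 2 ≤ count P
    2≤P = count-≥2 P (e⊆P (inj₁ refl)) (e⊆P (inj₂ refl)) (loopless e)
    some-R : ∃[ f ] R f ≡ true
    some-R = count-witness R (≤-pred (≤-trans 2≤P bound))
    e≢f : e ≢ proj₁ some-R
    e≢f e≡f = true≢false (trans (sym (∧-trueˡ (proj₂ some-R))) (trans (cong y (sym e≡f)) ye))
    2≤r : 2 ≤ count R
    2≤r = ≤-pred (≤-trans (distinct-edges-three-ends P e≢f e⊆P (R⊆P (proj₂ some-R))) bound)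
    r≤1 : count R ≤ 1
    r≤1 = +-cancelʳ-≤ (count R) (count R) 1
            (≤-trans (matching-covers (IsMatching-⊆ (λ _ → ∧-trueˡ) y-matching) R⊆P) bound)

  ineqs⇒y≗inE : ∀ {𝒰 : VSet G → ESet G → Set} → (∀ e → ∃[ W ] ∃[ F ] (𝒰 W F × inE G W e ≡ true))
    → ∀ {x : VSet G} {y : ESet G} → (∀ W F → 𝒰 W F → CliqueIneq G x y W F) → (∀ v → DegreeIneq G x y v)
    → y ≗ inE G x
  ineqs⇒y≗inE cover {x} {y} clique degree e with y e in ye | inE G x e in ex
  ... | true | _ = sym (trans (sym ex) (∧-true (y⊆x ye (inj₁ refl)) (y⊆x ye (inj₂ refl))))
    where
    y⊆x = degreeIneq⇒ends degree
  ... | false | false = refl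
  ... | false | true with cover e
  ...   | W , F , u , ew = trans (sym ye)
          (matching-saturates (degreeIneq⇒matching degree) (degreeIneq⇒ends degree)
            (m+n≤o⇒m≤o _ (clique W F u)) ex ew)

mainTheorem13 : (G : Graph)
    → (𝒰 : VSet G → ESet G → Set)
    → (∀ W F → 𝒰 W F → IsUtterClique G W F)
    → (∀ e → ∃[ W ] ∃[ F ] (𝒰 W F × inE G W e ≡ true))
    → (x : VSet G) → (y : ESet G)
    → (∃[ S ] (IsCo2Plex G S × IsExtIncidence G S x y))
    ⇔ ((∀ W F → 𝒰 W F → CliqueIneq G x y W F)
    × (∀ v → DegreeIneq G x y v))
mainTheorem13 G 𝒰 utter cover x y = mk⇔ necessary sufficient
  where
  necessary : ∃[ S ] (IsCo2Plex G S × IsExtIncidence G S x y)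
    → (∀ W F → 𝒰 W F → CliqueIneq G x y W F) × (∀ v → DegreeIneq G x y v)
  necessary (S , co , x≗S , y≗E[S]) =
      (λ W F u → cliqueIneq-cong G {F = F} (sym ∘ x≗S) (sym ∘ y≗E[S]) (co2plex-cliqueIneq G co (utter W F u)))
    , (λ v → degreeIneq-cong G (sym ∘ x≗S) (sym ∘ y≗E[S]) (co2plex-degreeIneq G co v))
  sufficient : (∀ W F → 𝒰 W F → CliqueIneq G x y W F) × (∀ v → DegreeIneq G x y v)
    → ∃[ S ] (IsCo2Plex G S × IsExtIncidence G S x y)
  sufficient (clique , degree) = x , (λ v _ → E[x]-matching v) , (λ _ → refl) , y≗E[x]
    where
    y≗E[x] : y ≗ inE G x
    y≗E[x] = ineqs⇒y≗inE G cover clique degree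
    E[x]-matching : IsMatching G (inE G x)
    E[x]-matching = IsMatching-cong G y≗E[x] (degreeIneq⇒matching G degree)
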